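{- Let $\ast_c$ be a choice revision on $K$ satisfying regularity: for all finite $A,B\subseteq\mathcal{L}$, if $A\cap(K\ast_c B)\neq\emptyset$ then $A\cap(K\ast_c A)\neq\emptyset$. Then $\ast_c$ satisfies reciprocity (for all finite $A,B$: if $(K\ast_c A)\cap B\neq\emptyset$ and $(K\ast_c B)\cap A\neq\emptyset$ then $K\ast_c A=K\ast_c B$) if and only if it satisfies strong reciprocity: for every $n\geq 1$ and all finite $A_0,\dots,A_n\subseteq\mathcal{L}$, if $(K\ast_c A_1)\cap A_0\neq\emptyset$, $\dots$, $(K\ast_c A_n)\cap A_{n-1}\neq\emptyset$ and $(K\ast_c A_0)\cap A_n\neq\emptyset$, then $K\ast_c A_0=K\ast_c A_1=\cdots=K\ast_c A_n$.
   Context: $\mathcal{L}$ is a propositional language; $\mathrm{Cn}$ is a supraclassical, compact consequence operation on $\mathcal{L}$ with the deduction property. A belief set is $X\subseteq\mathcal{L}$ with $X=\mathrm{Cn}(X)$; $K$ is a fixed consistent belief set. A choice revision on $K$ is a function $\ast_c$ assigning to each finite $A\subseteq\mathcal{L}$ a set $K\ast_c A\subseteq\mathcal{L}$. -}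

module Defs where

open import Level using (0ℓ)
open import Data.Nat using (ℕ; suc; _≤_)
open import Data.Fin using (Fin; zero; suc; inject₁; fromℕ)
open import Data.List using (List)
open import Data.List.Membership.Propositional using (_∈_)
open import Data.Product using (∃; _×_)
open import Relation.Unary using (Pred; _≐_)

-- Finite subsets of the language L are represented by lists of formulas;
-- membership is list membership.
FinSet : Set → Set
FinSet L = List L

ChoiceRevision : Set → Set₁
ChoiceRevision L = FinSet L → Pred L 0ℓ

Meets : {L : Set} → Pred L 0ℓ → FinSet L → Set
Meets {L} X A = ∃ λ (φ : L) → X φ × φ ∈ A

Regularity : {L : Set} → ChoiceRevision L → Set
Regularity {L} rev = (A B : FinSet L) → Meets (rev B) A → Meets (rev A) A

Reciprocity : {L : Set} → ChoiceRevision L → Set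
Reciprocity {L} rev = (A B : FinSet L) →
  Meets (rev A) B → Meets (rev B) A → rev A ≐ rev B

StrongReciprocity : {L : Set} → ChoiceRevision L → Set
StrongReciprocity {L} rev = (n : ℕ) → 1 ≤ n → (A : Fin (suc n) → FinSet L) →
  ((i : Fin n) → Meets (rev (A (suc i))) (A (inject₁ i))) →
  Meets (rev (A zero)) (A (fromℕ n)) →
  (i j : Fin (suc n)) → rev (A i) ≐ rev (A j)

-- The union U of the cycle is the pivot: regularity makes K ∗ U meet U, hence some Aᵢ;
-- whenever K ∗ U meets Aᵢ, reciprocity gives K ∗ Aᵢ = K ∗ U, which meets the cyclic
-- predecessor of Aᵢ, so this propagates around the whole cycle.

module Submission where

open import Defs
open import Function.Bundles using (_⇔_)
open import Relation.Unary using (Pred)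
open import Level using (0ℓ)

open import Function.Bundles using (mk⇔)
open import Data.Product using (_,_; ∃; proj₁; proj₂)
open import Data.Nat using (ℕ; zero; suc; s≤s; z≤n)
open import Data.Fin using (Fin; zero; suc; inject₁; fromℕ)
open import Data.List using (concat; tabulate)
open import Data.List.Membership.Propositional using (_∈_)
open import Data.List.Membership.Propositional.Properties
  using (∈-concat⁺′; ∈-concat⁻′; ∈-tabulate⁺; ∈-tabulate⁻)
open import Relation.Unary using (_⊆_; _≐_)
open import Relation.Unary.Properties using (≐-sym; ≐-trans)
open import Relation.Binary.PropositionalEquality using (subst)

⋃ : {L : Set} {m : ℕ} → (Fin m → FinSet L) → FinSet L
⋃ A = concat (tabulate A)

module _ {L : Set} where

  Meets-⊆ : {X Y : Pred L 0ℓ} {A : FinSet L} → X ⊆ Y → Meets X A → Meets Y A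
  Meets-⊆ X⊆Y (φ , φ∈X , φ∈A) = φ , X⊆Y φ∈X , φ∈A

  Meets-⋃⁺ : {m : ℕ} {X : Pred L 0ℓ} (A : Fin m → FinSet L) (i : Fin m) →
    Meets X (A i) → Meets X (⋃ A)
  Meets-⋃⁺ A i (φ , φ∈X , φ∈Ai) = φ , φ∈X , ∈-concat⁺′ φ∈Ai (∈-tabulate⁺ i)

  Meets-⋃⁻ : {m : ℕ} {X : Pred L 0ℓ} (A : Fin m → FinSet L) →
    Meets X (⋃ A) → ∃ λ i → Meets X (A i)
  Meets-⋃⁻ A (φ , φ∈X , φ∈⋃A) with ∈-concat⁻′ (tabulate A) φ∈⋃A
  ... | B , φ∈B , B∈A with ∈-tabulate⁻ B∈A
  ... | i , B≡Ai = i , φ , φ∈X , subst (φ ∈_) B≡Ai φ∈B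

cpred : {n : ℕ} → Fin (suc n) → Fin (suc n)
cpred {n} zero = fromℕ n
cpred (suc i) = inject₁ i

downward-to-zero : {m : ℕ} (P : Fin (suc m) → Set) →
  ((i : Fin m) → P (suc i) → P (inject₁ i)) → (i : Fin (suc m)) → P i → P zero
downward-to-zero P step zero p = p
downward-to-zero {suc m} P step (suc i) p =
  downward-to-zero (λ k → P (inject₁ k)) (λ k → step (inject₁ k)) i (step i p)

downward-from-top : {m : ℕ} (P : Fin (suc m) → Set) →
  ((i : Fin m) → P (suc i) → P (inject₁ i)) → P (fromℕ m) → (j : Fin (suc m)) → P j
downward-from-top {zero} P step p zero = p
downward-from-top {suc m} P step p zero =
  step zero (downward-from-top (λ k → P (suc k)) (λ k → step (suc k)) p zero)
downward-from-top {suc m} P step p (suc j) =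
  downward-from-top (λ k → P (suc k)) (λ k → step (suc k)) p j

cpred-closed⇒constant : {n : ℕ} (P : Fin (suc n) → Set) →
  ((i : Fin (suc n)) → P i → P (cpred i)) → (i j : Fin (suc n)) → P i → P j
cpred-closed⇒constant P closed i j p =
  downward-from-top P step (closed zero (downward-to-zero P step i p)) j
  where
  step : (k : Fin _) → P (suc k) → P (inject₁ k)
  step k = closed (suc k)

module _ {L : Set} {rev : ChoiceRevision L} (reg : Regularity rev) (rec : Reciprocity rev)
  {n : ℕ} (A : Fin (suc n) → FinSet L)
  (meets-next : (i : Fin n) → Meets (rev (A (suc i))) (A (inject₁ i)))
  (meets-last : Meets (rev (A zero)) (A (fromℕ n))) where

  private
    U : FinSet L
    U = ⋃ A

    meets-cpred : (i : Fin (suc n)) → Meets (rev (A i)) (A (cpred i))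
    meets-cpred zero = meets-last
    meets-cpred (suc i) = meets-next i

    agrees-with-union : (i : Fin (suc n)) → Meets (rev U) (A i) → rev (A i) ≐ rev U
    agrees-with-union i = rec (A i) U (Meets-⋃⁺ A (cpred i) (meets-cpred i))

    union-meets-all : (j : Fin (suc n)) → Meets (rev U) (A j)
    union-meets-all j =
      let i , meets-Ai = Meets-⋃⁻ A (reg U (A zero) (Meets-⋃⁺ A (fromℕ n) meets-last))
      in cpred-closed⇒constant (λ k → Meets (rev U) (A k))
           (λ k m → Meets-⊆ (proj₁ (agrees-with-union k m)) (meets-cpred k)) i j meets-Ai

  cycle-revisions-agree : (i j : Fin (suc n)) → rev (A i) ≐ rev (A j)
  cycle-revisions-agree i j =
    ≐-trans (agrees-with-union i (union-meets-all i))
            (≐-sym (agrees-with-union j (union-meets-all j)))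

reciprocity⇒strongReciprocity : {L : Set} {rev : ChoiceRevision L} →
  Regularity rev → Reciprocity rev → StrongReciprocity rev
reciprocity⇒strongReciprocity reg rec _ _ = cycle-revisions-agree reg rec

strongReciprocity⇒reciprocity : {L : Set} {rev : ChoiceRevision L} →
  StrongReciprocity rev → Reciprocity rev
strongReciprocity⇒reciprocity sr A B rev-A-meets-B rev-B-meets-A =
  sr 1 (s≤s z≤n) (λ { zero → A ; (suc zero) → B })
     (λ { zero → rev-B-meets-A }) rev-A-meets-B zero (suc zero)

mainTheorem4 : (L : Set) (K : Pred L 0ℓ) (rev : ChoiceRevision L) →
    Regularity rev → (Reciprocity rev ⇔ StrongReciprocity rev)
mainTheorem4 _ _ _ reg =
  mk⇔ (reciprocity⇒strongReciprocity reg) strongReciprocity⇒reciprocity
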